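{- If $G$ is a split graph, then $t(\overline{G})\le 2\,\mathrm{box}(G)$.
   Context: All graphs are finite, simple and undirected; $\overline{G}$ is the complement of $G$. A split graph is a graph whose vertex set can be partitioned into a clique and an independent set. A threshold graph is a graph $G=(V,E)$ admitting a real $S$ and $w:V\to\mathbb{R}$ with distinct $u,v$ adjacent iff $w(u)+w(v)\ge S$. The threshold dimension $t(G)$ is the least $k$ such that there are threshold graphs $G_1,\dots,G_k$ on $V(G)$ with $E(G)=\bigcup_i E(G_i)$. The boxicity $\mathrm{box}(G)$ is the minimum $k$ such that $G$ is the intersection graph of $k$-dimensional axis-parallel boxes; equivalently the minimum $k$ such that $G$ is the intersection (common vertex set, intersected edge sets) of $k$ interval graphs.
   Formalization: The weights $w$ and the threshold $S$ of threshold graphs, and the endpoints of the intervals in the interval graphs defining boxicity, are rational numbers instead of reals. -}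

module Defs where

open import Data.Nat using (ℕ; _≤_)
open import Data.Fin using (Fin)
open import Data.Bool using (Bool; true; false; not)
open import Data.Product using (Σ; ∃; _×_; _,_)
open import Data.Rational using (ℚ; _+_) renaming (_≤_ to _≤ℚ_)
open import Relation.Binary.PropositionalEquality using (_≡_; _≢_)
open import Function.Bundles using (_⇔_)

record Graph (n : ℕ) : Set where
  field
    adj    : Fin n → Fin n → Bool
    adj-sym : ∀ u v → adj u v ≡ adj v u
    adj-irrefl : ∀ u → adj u u ≡ false
open Graph public

Adj : ∀ {n} → Graph n → Fin n → Fin n → Set
Adj G u v = adj G u v ≡ true

complement : ∀ {n} → Graph n → Graph n
complement {n} G = record { adj = adj′ ; adj-sym = sym′ ; adj-irrefl = irr′ }
  where
    open import Data.Fin using (_≟_)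
    open import Relation.Nullary using (yes; no)
    open import Relation.Binary.PropositionalEquality using (refl; cong; sym)
    adj′ : Fin n → Fin n → Bool
    adj′ u v with u ≟ v
    ... | yes _ = false
    ... | no  _ = not (adj G u v)
    sym′ : ∀ u v → adj′ u v ≡ adj′ v u
    sym′ u v with u ≟ v | v ≟ u
    ... | yes _ | yes _ = refl
    ... | yes p | no ¬q = Data.Empty.⊥-elim (¬q (sym p))
      where import Data.Empty
    ... | no ¬p | yes q = Data.Empty.⊥-elim (¬p (sym q))
      where import Data.Empty
    ... | no _  | no _  = cong not (adj-sym G u v)
    irr′ : ∀ u → adj′ u u ≡ false
    irr′ u with u ≟ u
    ... | yes _ = refl
    ... | no ¬p = Data.Empty.⊥-elim (¬p refl)
      where import Data.Empty

IsSplit : ∀ {n} → Graph n → Set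
IsSplit {n} G = Σ (Fin n → Bool) λ C →
    (∀ u v → C u ≡ true  → C v ≡ true  → u ≢ v → Adj G u v)
  × (∀ u v → C u ≡ false → C v ≡ false → adj G u v ≡ false)

-- Threshold graph: there are S and weights w with distinct u,v adjacent iff w u + w v ≥ S.
-- (Weights are rational; for finite graphs this is equivalent to real weights.)
IsThreshold : ∀ {n} → Graph n → Set
IsThreshold {n} G = Σ ℚ λ S → Σ (Fin n → ℚ) λ w →
  ∀ u v → u ≢ v → (Adj G u v ⇔ (S ≤ℚ w u + w v))

IsInterval : ∀ {n} → Graph n → Set
IsInterval {n} G = Σ (Fin n → ℚ) λ l → Σ (Fin n → ℚ) λ r →
    (∀ u → l u ≤ℚ r u)
  × (∀ u v → u ≢ v → (Adj G u v ⇔ (l u ≤ℚ r v × l v ≤ℚ r u)))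

ThresholdCover : ∀ {n} → Graph n → ℕ → Set
ThresholdCover {n} G k = Σ (Fin k → Graph n) λ H →
    (∀ i → IsThreshold (H i))
  × (∀ u v → u ≢ v → (Adj G u v ⇔ ∃ λ i → Adj (H i) u v))

BoxRep : ∀ {n} → Graph n → ℕ → Set
BoxRep {n} G k = Σ (Fin k → Graph n) λ H →
    (∀ i → IsInterval (H i))
  × (∀ u v → u ≢ v → (Adj G u v ⇔ (∀ i → Adj (H i) u v)))

IsThresholdDim : ∀ {n} → Graph n → ℕ → Set
IsThresholdDim G t = ThresholdCover G t × (∀ k → ThresholdCover G k → t ≤ k)

IsBoxicity : ∀ {n} → Graph n → ℕ → Set
IsBoxicity G b = BoxRep G b × (∀ k → BoxRep G k → b ≤ k)

-- Let K, I be the clique and the independent set of G and fix intervals [l x, r x] in one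
-- coordinate of a box representation. Distinct u, v are non-adjacent in G iff both lie in I,
-- or one lies in K, the other in I, and in some coordinate the I-interval lies entirely to
-- the left or entirely to the right of the K-interval. For each coordinate and each side,
-- the graph with all I–I edges and these K–I edges is a threshold graph: give x ∈ K the weight
-- #{z : r z < l x} and y ∈ I the weight 2n + 1 − #{z : r z ≤ r y}; then r y < l x iff
-- {z : r z ≤ r y} ⊆ {z : r z < l x} iff the first count is at most the second. The 2·box(G)
-- threshold graphs so obtained cover the complement of G.
module Submission where

open import Defs
open import Data.Nat using (ℕ; _≤_; _*_)
open import Data.Nat as ℕ using (zero; suc; _+_; _∸_; _<_; z≤n; s≤s)
import Data.Nat.Properties as ℕₚ
open import Data.Fin using (Fin; zero; suc; _≟_; remQuot; combine)
open import Data.Fin.Properties using (remQuot-combine; ¬∀⟶∃¬)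
open import Data.Fin.Subset using (Subset; _∈_; _⊂_; ∣_∣)
open import Data.Fin.Subset.Properties using (∣p∣≤n; p⊆q⇒∣p∣≤∣q∣; p⊂q⇒∣p∣<∣q∣)
open import Data.Vec using (tabulate)
open import Data.Vec.Properties using (lookup∘tabulate; []=⇒lookup; lookup⇒[]=)
open import Data.Bool using (Bool; true; false; if_then_else_)
import Data.Bool as Bool
open import Data.Product using (∃; ∃₂; _×_; _,_; proj₁; proj₂; uncurry)
open import Data.Rational as ℚ using (ℚ; 0ℚ; 1ℚ; -_)
import Data.Rational.Properties as ℚₚ
open import Relation.Nullary using (¬_; Dec; yes; no; does; contradiction)
open import Relation.Unary using (Pred; Decidable)
open import Relation.Binary.PropositionalEquality
open import Function using (_∘_)
open import Function.Bundles using (_⇔_; mk⇔; Equivalence)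
import Function.Properties.Equivalence as ⇔

does⇔ : ∀ {a} {A : Set a} (A? : Dec A) → does A? ≡ true ⇔ A
does⇔ (yes a)  = mk⇔ (λ _ → a) (λ _ → refl)
does⇔ (no ¬a) = mk⇔ (λ ()) (λ a → contradiction a ¬a)

symmetricGraph : ∀ {n} (f : Fin n → Fin n → Bool) → (∀ x y → f x y ≡ f y x) → Graph n
symmetricGraph {n} f f-sym = record { adj = f′ ; adj-sym = f′-sym ; adj-irrefl = f′-irrefl }
  where
  f′ : Fin n → Fin n → Bool
  f′ x y with x ≟ y
  ... | yes _ = false
  ... | no  _ = f x y
  f′-sym : ∀ x y → f′ x y ≡ f′ y x
  f′-sym x y with x ≟ y | y ≟ x
  ... | yes _   | yes _   = refl
  ... | yes x≡y | no  y≢x = contradiction (sym x≡y) y≢x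
  ... | no  x≢y | yes y≡x = contradiction (sym y≡x) x≢y
  ... | no  _   | no  _   = f-sym x y
  f′-irrefl : ∀ x → f′ x x ≡ false
  f′-irrefl x with x ≟ x
  ... | yes _   = refl
  ... | no  x≢x = contradiction refl x≢x

adj-symmetricGraph : ∀ {n} f f-sym {u v : Fin n} → u ≢ v → adj (symmetricGraph f f-sym) u v ≡ f u v
adj-symmetricGraph f f-sym {u} {v} u≢v with u ≟ v
... | yes u≡v = contradiction u≡v u≢v
... | no  _   = refl

Adj-sym : ∀ {n} (G : Graph n) u v → Adj G u v → Adj G v u
Adj-sym G u v = trans (adj-sym G v u)

Adj-complement : ∀ {n} (G : Graph n) {u v} → u ≢ v → Adj (complement G) u v ⇔ (¬ Adj G u v)
Adj-complement G {u} {v} u≢v with u ≟ v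
... | yes u≡v = contradiction u≡v u≢v
... | no  _ with adj G u v
...   | true  = mk⇔ (λ ()) (λ ¬a → contradiction refl ¬a)
...   | false = mk⇔ (λ _ ()) (λ _ → refl)

fromℕ : ℕ → ℚ
fromℕ zero    = 0ℚ
fromℕ (suc k) = 1ℚ ℚ.+ fromℕ k

fromℕ-+ : ∀ m k → fromℕ (m + k) ≡ fromℕ m ℚ.+ fromℕ k
fromℕ-+ zero    k = sym (ℚₚ.+-identityˡ (fromℕ k))
fromℕ-+ (suc m) k = trans (cong (1ℚ ℚ.+_) (fromℕ-+ m k)) (sym (ℚₚ.+-assoc 1ℚ (fromℕ m) (fromℕ k)))

fromℕ-<-suc : ∀ k → fromℕ k ℚ.< fromℕ (suc k)
fromℕ-<-suc k = subst (ℚ._< fromℕ (suc k)) (ℚₚ.+-identityˡ (fromℕ k))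
                  (ℚₚ.+-monoˡ-< (fromℕ k) (ℚₚ.positive⁻¹ 1ℚ))

fromℕ-nonNeg : ∀ k → 0ℚ ℚ.≤ fromℕ k
fromℕ-nonNeg zero    = ℚₚ.≤-refl
fromℕ-nonNeg (suc k) = ℚₚ.≤-trans (fromℕ-nonNeg k) (ℚₚ.<⇒≤ (fromℕ-<-suc k))

fromℕ-mono-≤ : ∀ {m k} → m ≤ k → fromℕ m ℚ.≤ fromℕ k
fromℕ-mono-≤ {k = k} z≤n  = fromℕ-nonNeg k
fromℕ-mono-≤ (s≤s m≤k)   = ℚₚ.+-monoʳ-≤ 1ℚ (fromℕ-mono-≤ m≤k)

fromℕ-mono-< : ∀ {m k} → m < k → fromℕ m ℚ.< fromℕ k
fromℕ-mono-< {m} m<k = ℚₚ.<-≤-trans (fromℕ-<-suc m) (fromℕ-mono-≤ m<k)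

fromℕ-cancel-≤ : ∀ {m k} → fromℕ m ℚ.≤ fromℕ k → m ≤ k
fromℕ-cancel-≤ {m} {k} le with m ℕ.≤? k
... | yes m≤k = m≤k
... | no  m≰k = contradiction (ℚₚ.<-≤-trans (fromℕ-mono-< (ℕₚ.≰⇒> m≰k)) le) (ℚₚ.<-irrefl refl)

fromℕ-≤-+⇔ : ∀ s m k → s ≤ m + k ⇔ fromℕ s ℚ.≤ fromℕ m ℚ.+ fromℕ k
fromℕ-≤-+⇔ s m k = mk⇔
  (λ le → subst (fromℕ s ℚ.≤_) (fromℕ-+ m k) (fromℕ-mono-≤ le))
  (λ le → fromℕ-cancel-≤ (subst (fromℕ s ℚ.≤_) (sym (fromℕ-+ m k)) le))

isThreshold-ℕ : ∀ {n} {G : Graph n} (S : ℕ) (w : Fin n → ℕ) →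
  (∀ u v → u ≢ v → Adj G u v ⇔ S ≤ w u + w v) → IsThreshold G
isThreshold-ℕ S w adj⇔ = fromℕ S , fromℕ ∘ w , λ u v u≢v →
  ⇔.trans (adj⇔ u v u≢v) (fromℕ-≤-+⇔ S (w u) (w v))

subsetOf : ∀ {n ℓ} {P : Pred (Fin n) ℓ} → Decidable P → Subset n
subsetOf P? = tabulate (does ∘ P?)

∈-subsetOf : ∀ {n ℓ} {P : Pred (Fin n) ℓ} (P? : Decidable P) {x} → x ∈ subsetOf P? ⇔ P x
∈-subsetOf P? {x} = ⇔.trans
  (mk⇔ (λ x∈ → trans (sym (lookup∘tabulate (does ∘ P?) x)) ([]=⇒lookup x∈))
       (λ d → lookup⇒[]= x _ (trans (lookup∘tabulate (does ∘ P?) x) d)))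
  (does⇔ (P? x))

below atMost : ∀ {n} → (Fin n → ℚ) → ℚ → Subset n
below  b q = subsetOf (λ z → b z ℚ.<? q)
atMost b q = subsetOf (λ z → b z ℚ.≤? q)

<⇔∣atMost∣≤∣below∣ : ∀ {n} (b : Fin n → ℚ) y q → b y ℚ.< q ⇔ ∣ atMost b (b y) ∣ ≤ ∣ below b q ∣
<⇔∣atMost∣≤∣below∣ b y q = mk⇔ atMost⊆below ∣atMost∣≤∣below∣⇒<
  where
  module A {z} = Equivalence (∈-subsetOf (λ z → b z ℚ.≤? b y) {z})
  module B {z} = Equivalence (∈-subsetOf (λ z → b z ℚ.<? q) {z})
  atMost⊆below : b y ℚ.< q → ∣ atMost b (b y) ∣ ≤ ∣ below b q ∣
  atMost⊆below by<q = p⊆q⇒∣p∣≤∣q∣ (λ z∈ → B.from (ℚₚ.≤-<-trans (A.to z∈) by<q))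
  ∣atMost∣≤∣below∣⇒< : ∣ atMost b (b y) ∣ ≤ ∣ below b q ∣ → b y ℚ.< q
  ∣atMost∣≤∣below∣⇒< le with b y ℚ.<? q
  ... | yes by<q = by<q
  ... | no  by≮q = contradiction le (ℕₚ.<⇒≱ (p⊂q⇒∣p∣<∣q∣ below⊂atMost))
    where
    below⊂atMost : below b q ⊂ atMost b (b y)
    below⊂atMost = (λ z∈ → A.from (ℚₚ.≤-trans (ℚₚ.<⇒≤ (B.to z∈)) (ℚₚ.≮⇒≥ by≮q)))
                 , y , A.from ℚₚ.≤-refl , by≮q ∘ B.to

≤+∸⇔≤ : ∀ {s c} m → c ≤ s → s ≤ m + (s ∸ c) ⇔ c ≤ m
≤+∸⇔≤ {s} {c} m c≤s = mk⇔
  (λ le → ℕₚ.+-cancelʳ-≤ (s ∸ c) c m (subst (_≤ m + (s ∸ c)) (sym (ℕₚ.m+[n∸m]≡n c≤s)) le))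
  (λ c≤m → subst (_≤ m + (s ∸ c)) (ℕₚ.m+[n∸m]≡n c≤s) (ℕₚ.+-monoˡ-≤ (s ∸ c) c≤m))

suc[n+n]≤∸+∸ : ∀ {n c c′} → c ≤ n → c′ ≤ n → suc (n + n) ≤ (suc (n + n) ∸ c) + (suc (n + n) ∸ c′)
suc[n+n]≤∸+∸ {n} c≤n c′≤n =
  ℕₚ.≤-trans (ℕₚ.+-monoʳ-≤ (suc n) (ℕₚ.n≤1+n n)) (ℕₚ.+-mono-≤ (suc-n≤ c≤n) (suc-n≤ c′≤n))
  where
  suc-n≤ : ∀ {c} → c ≤ n → suc n ≤ suc (n + n) ∸ c
  suc-n≤ {c} c≤n = subst (_≤ suc (n + n) ∸ c) (ℕₚ.m+n∸n≡m (suc n) n) (ℕₚ.∸-monoʳ-≤ (suc (n + n)) c≤n)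

module _ {n ℓ} (C : Fin n → Bool) {_≺_ : Fin n → Fin n → Set ℓ} (_≺?_ : ∀ x y → Dec (x ≺ y)) where

  splitAdj : Fin n → Fin n → Bool
  splitAdj x y with C x | C y
  ... | true  | true  = false
  ... | true  | false = does (x ≺? y)
  ... | false | true  = does (y ≺? x)
  ... | false | false = true

  splitAdj-sym : ∀ x y → splitAdj x y ≡ splitAdj y x
  splitAdj-sym x y with C x | C y
  ... | true  | true  = refl
  ... | true  | false = refl
  ... | false | true  = refl
  ... | false | false = refl

  splitGraph : Graph n
  splitGraph = symmetricGraph splitAdj splitAdj-sym

  Adj-splitGraph⇔ : ∀ {u v} → u ≢ v → Adj splitGraph u v ⇔ splitAdj u v ≡ true
  Adj-splitGraph⇔ u≢v = mk⇔ (trans (sym adj≡)) (trans adj≡)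
    where adj≡ = adj-symmetricGraph splitAdj splitAdj-sym u≢v

  splitGraph-clique : ∀ {u v} → u ≢ v → C u ≡ true → C v ≡ true → ¬ Adj splitGraph u v
  splitGraph-clique u≢v cu cv rewrite adj-symmetricGraph splitAdj splitAdj-sym u≢v | cu | cv = λ ()

  splitGraph-cross : ∀ {u v} → u ≢ v → C u ≡ true → C v ≡ false → Adj splitGraph u v ⇔ u ≺ v
  splitGraph-cross {u} {v} u≢v cu cv
    rewrite adj-symmetricGraph splitAdj splitAdj-sym u≢v | cu | cv = does⇔ (u ≺? v)

  splitGraph-independent : ∀ {u v} → u ≢ v → C u ≡ false → C v ≡ false → Adj splitGraph u v
  splitGraph-independent u≢v cu cv rewrite adj-symmetricGraph splitAdj splitAdj-sym u≢v | cu | cv = refl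

  splitGraph-isThreshold : (N c : Fin n → ℕ) → (∀ x → N x ≤ n) → (∀ y → c y ≤ n) →
    (∀ x y → x ≺ y ⇔ c y ≤ N x) → IsThreshold splitGraph
  splitGraph-isThreshold N c N≤n c≤n ≺⇔ =
    isThreshold-ℕ {G = splitGraph} S w λ u v u≢v → ⇔.trans (Adj-splitGraph⇔ u≢v) (splitAdj⇔ u v)
    where
    -- Clique weights are ≤ n and independent weights ≥ n + 1: no K–K pair and every I–I pair reaches S.
    S : ℕ
    S = suc (n + n)
    w : Fin n → ℕ
    w x = if C x then N x else S ∸ c x
    c≤S : ∀ y → c y ≤ S
    c≤S y = ℕₚ.m≤n⇒m≤1+n (ℕₚ.m≤n⇒m≤n+o n (c≤n y))
    splitAdj⇔ : ∀ u v → splitAdj u v ≡ true ⇔ S ≤ w u + w v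
    splitAdj⇔ u v with C u | C v
    ... | true  | true  = mk⇔ (λ ())
                              (λ le → contradiction le (ℕₚ.<⇒≱ (s≤s (ℕₚ.+-mono-≤ (N≤n u) (N≤n v)))))
    ... | true  | false = ⇔.trans (⇔.trans (does⇔ (u ≺? v)) (≺⇔ u v)) (⇔.sym (≤+∸⇔≤ (N u) (c≤S v)))
    ... | false | true  = ⇔.trans (⇔.trans (does⇔ (v ≺? u)) (≺⇔ v u))
                            (⇔.sym (subst (λ m → S ≤ m ⇔ c u ≤ N v) (ℕₚ.+-comm (N v) _)
                                            (≤+∸⇔≤ (N v) (c≤S u))))
    ... | false | false = mk⇔ (λ _ → suc[n+n]≤∸+∸ (c≤n u) (c≤n v)) (λ _ → refl)

precedenceGraph : ∀ {n} (C : Fin n → Bool) (a b : Fin n → ℚ) → Graph n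
precedenceGraph C a b = splitGraph C (λ x y → b y ℚ.<? a x)

precedenceGraph-isThreshold : ∀ {n} (C : Fin n → Bool) (a b : Fin n → ℚ) →
  IsThreshold (precedenceGraph C a b)
precedenceGraph-isThreshold C a b = splitGraph-isThreshold C (λ x y → b y ℚ.<? a x)
  (λ x → ∣ below b (a x) ∣) (λ y → ∣ atMost b (b y) ∣)
  (λ x → ∣p∣≤n (below b (a x))) (λ y → ∣p∣≤n (atMost b (b y)))
  (λ x y → <⇔∣atMost∣≤∣below∣ b y (a x))

module Interval {n} (H : Graph n) (I : IsInterval H) where

  lo hi : Fin n → ℚ
  lo = proj₁ I
  hi = proj₁ (proj₂ I)

  Adj⇔overlap : ∀ {u v} → u ≢ v → Adj H u v ⇔ (lo u ℚ.≤ hi v × lo v ℚ.≤ hi u)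
  Adj⇔overlap = proj₂ (proj₂ (proj₂ I)) _ _

  -- end s v < start s u: the interval of v lies left (s = zero) or, after the reflection
  -- x ↦ - x, right (s = suc zero) of that of u.
  start end : Fin 2 → Fin n → ℚ
  start zero       = lo
  start (suc zero) = λ x → - hi x
  end zero       = hi
  end (suc zero) = λ x → - lo x

  before⇒¬Adj : ∀ s {u v} → u ≢ v → end s v ℚ.< start s u → ¬ Adj H u v
  before⇒¬Adj zero       u≢v v<u a =
    ℚₚ.<-irrefl refl (ℚₚ.<-≤-trans v<u (proj₁ (Equivalence.to (Adj⇔overlap u≢v) a)))
  before⇒¬Adj (suc zero) u≢v v<u a =
    ℚₚ.<-irrefl refl (ℚₚ.<-≤-trans v<u (ℚₚ.neg-antimono-≤ (proj₂ (Equivalence.to (Adj⇔overlap u≢v) a))))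

  ¬Adj⇒before : ∀ {u v} → u ≢ v → ¬ Adj H u v → ∃ λ s → end s v ℚ.< start s u
  ¬Adj⇒before {u} {v} u≢v ¬a with lo u ℚ.≤? hi v | lo v ℚ.≤? hi u
  ... | no  lu≰hv | _         = zero , ℚₚ.≰⇒> lu≰hv
  ... | yes _     | no  lv≰hu = suc zero , ℚₚ.neg-antimono-< (ℚₚ.≰⇒> lv≰hu)
  ... | yes lu≤hv | yes lv≤hu = contradiction (Equivalence.from (Adj⇔overlap u≢v) (lu≤hv , lv≤hu)) ¬a

¬Adj⇔∃¬Adj : ∀ {n k} (G : Graph n) (B : BoxRep G k) {u v} → u ≢ v →
  (¬ Adj G u v) ⇔ (∃ λ i → ¬ Adj (proj₁ B i) u v)
¬Adj⇔∃¬Adj {k = k} G (H , _ , rep) {u} {v} u≢v = mk⇔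
  (λ ¬a → ¬∀⟶∃¬ k (λ i → Adj (H i) u v) (λ i → adj (H i) u v Bool.≟ true)
            (¬a ∘ Equivalence.from (rep u v u≢v)))
  (λ (i , ¬h) a → ¬h (Equivalence.to (rep u v u≢v) a i))

thresholdCover-product : ∀ {n m k} {G : Graph n} (F : Fin m → Fin k → Graph n) →
  (∀ s i → IsThreshold (F s i)) →
  (∀ u v → u ≢ v → Adj G u v ⇔ (∃₂ λ s i → Adj (F s i) u v)) →
  ThresholdCover G (m * k)
thresholdCover-product {m = m} {k = k} F F-threshold cover =
  (λ j → uncurry F (remQuot {m} k j)) , (λ j → uncurry F-threshold (remQuot {m} k j)) ,
  λ u v u≢v →
  ⇔.trans (cover u v u≢v) (mk⇔
    (λ (s , i , a) → combine s i , subst (λ si → Adj (uncurry F si) u v) (sym (remQuot-combine s i)) a)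
    (λ (j , a) → proj₁ (remQuot {m} k j) , proj₂ (remQuot {m} k j) , a))

module SplitComplement {n} {G : Graph n} (split : IsSplit G) {b} (box : BoxRep G b) where

  C : Fin n → Bool
  C = proj₁ split

  clique : ∀ u v → C u ≡ true → C v ≡ true → u ≢ v → Adj G u v
  clique = proj₁ (proj₂ split)

  independent : ∀ u v → C u ≡ false → C v ≡ false → adj G u v ≡ false
  independent = proj₂ (proj₂ split)

  open module Coordinate i = Interval (proj₁ box i) (proj₁ (proj₂ box) i)
    using (start; end; before⇒¬Adj; ¬Adj⇒before)

  T : Fin 2 → Fin b → Graph n
  T s i = precedenceGraph C (start i s) (end i s)

  ∃T-sym : ∀ u v → (∃₂ λ s i → Adj (T s i) u v) → ∃₂ λ s i → Adj (T s i) v u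
  ∃T-sym u v (s , i , a) = s , i , Adj-sym (T s i) u v a

  cross-¬Adj⇔∃T : ∀ u v → u ≢ v → C u ≡ true → C v ≡ false →
    (¬ Adj G u v) ⇔ (∃₂ λ s i → Adj (T s i) u v)
  cross-¬Adj⇔∃T u v u≢v cu cv = ⇔.trans (¬Adj⇔∃¬Adj G box u≢v) (mk⇔
    (λ (i , ¬h) → let (s , v<u) = ¬Adj⇒before i u≢v ¬h in
                  s , i , Equivalence.from (splitGraph-cross C _ u≢v cu cv) v<u)
    (λ (s , i , a) → i , before⇒¬Adj i s u≢v (Equivalence.to (splitGraph-cross C _ u≢v cu cv) a)))

  ¬Adj⇔∃T : ∀ u v → u ≢ v → (¬ Adj G u v) ⇔ (∃₂ λ s i → Adj (T s i) u v)
  ¬Adj⇔∃T u v u≢v = bySides (C u) (C v) refl refl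
    where
    -- Matching with `with C u` would also abstract C u inside the graphs T s i.
    bySides : ∀ cᵤ cᵥ → C u ≡ cᵤ → C v ≡ cᵥ → (¬ Adj G u v) ⇔ (∃₂ λ s i → Adj (T s i) u v)
    bySides true  true  cu cv = mk⇔ (λ ¬a → contradiction (clique u v cu cv u≢v) ¬a)
                                    (λ (s , i , a) → contradiction a (splitGraph-clique C _ u≢v cu cv))
    bySides true  false cu cv = cross-¬Adj⇔∃T u v u≢v cu cv
    bySides false true  cu cv = mk⇔
      (∃T-sym v u ∘ Equivalence.to (cross-¬Adj⇔∃T v u (u≢v ∘ sym) cv cu) ∘ (_∘ Adj-sym G v u))
      (λ e → Equivalence.from (cross-¬Adj⇔∃T v u (u≢v ∘ sym) cv cu) (∃T-sym u v e) ∘ Adj-sym G u v)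
    bySides false false cu cv = mk⇔
      (λ ¬a → let (i , _) = Equivalence.to (¬Adj⇔∃¬Adj G box u≢v) ¬a in
              zero , i , splitGraph-independent C _ u≢v cu cv)
      (λ _ a → contradiction (trans (sym a) (independent u v cu cv)) λ ())

  complement-thresholdCover : ThresholdCover (complement G) (2 * b)
  complement-thresholdCover = thresholdCover-product {G = complement G} T
    (λ s i → precedenceGraph-isThreshold C (start i s) (end i s))
    (λ u v u≢v → ⇔.trans (Adj-complement G u≢v) (¬Adj⇔∃T u v u≢v))

lemma6 : ∀ {n} (G : Graph n) → IsSplit G →
    ∀ (t b : ℕ) → IsThresholdDim (complement G) t → IsBoxicity G b → t ≤ 2 * b
lemma6 G split t b (_ , t-least) (box , _) =
  t-least (2 * b) (SplitComplement.complement-thresholdCover split box)
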